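{- For any integers $k \geq 2$, $M \geq 0$ and $0\le \alpha \le M$, $$U^M_{k,(\alpha,M)}(t) = \frac{C_{k,(\alpha,M)}(t)}{1+C_{k,(M+1,M)}(t)}.$$
   Context: For an integer $k\ge 2$ and integers $\alpha,\beta, n\ge 0$, let $\mathcal{D}^k_{n,(\alpha,\beta)}$ be the set of integer lattice paths from $(0,\alpha)$ to $(kn+\beta-\alpha,\beta)$ using steps $U=(1,1)$ and $D=(1,1-k)$ that stay weakly above the line $y=0$ (such paths have exactly $n$ steps $D$; the empty path is included when $n=0$, $\alpha=\beta$), $C^k_{n,(\alpha,\beta)}=|\mathcal{D}^k_{n,(\alpha,\beta)}|$ and $C_{k,(\alpha,\beta)}(t)=\sum_{n\ge0}C^k_{n,(\alpha,\beta)}t^n$. For $M\ge0$ and $0\le\alpha,\beta\le M$, $U^{k,M}_{n,(\alpha,\beta)}$ is the number of paths in $\mathcal{D}^k_{n,(\alpha,\beta)}$ that stay weakly below the line $y=M$, and $U^M_{k,(\alpha,\beta)}(t)=\sum_{n\ge0}U^{k,M}_{n,(\alpha,\beta)}t^n$. -}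

module Defs where

open import Data.Nat as ℕ using (ℕ; zero; suc)
open import Data.Integer as ℤ using (ℤ; +_; +[1+_]; -[1+_]; _≤_; _≤?_)
import Data.Integer.Properties as ℤP
open import Data.List using (List; []; _∷_; length; filter; map; _++_)
open import Data.List.Relation.Unary.All using (All; all?)
open import Data.Product using (_×_)
open import Relation.Nullary.Decidable using (Dec; _×-dec_)
open import Relation.Binary.PropositionalEquality using (_≡_)

-- Steps of a path: U = (1,1), D = (1,1-k).
data Step : Set where
  U D : Step

-- all step sequences of a given length (= horizontal extent of the path)
allSeqs : ℕ → List (List Step)
allSeqs zero    = [] ∷ []
allSeqs (suc m) = map (U ∷_) (allSeqs m) ++ map (D ∷_) (allSeqs m)

stepH : ℕ → Step → ℤ → ℤ
stepH k U y = y ℤ.+ + 1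
stepH k D y = (y ℤ.+ + 1) ℤ.- + k

heights : ℕ → ℤ → List Step → List ℤ
heights k y []       = y ∷ []
heights k y (s ∷ ss) = y ∷ heights k (stepH k s y) ss

endH : ℕ → ℤ → List Step → ℤ
endH k y []       = y
endH k y (s ∷ ss) = endH k (stepH k s y) ss

-- A step sequence is a path in D^k_{n,(α,β)} (given its length is kn+β-α):
-- it ends at height β and stays weakly above y = 0.
IsDyck : ℕ → ℕ → ℕ → List Step → Set
IsDyck k α β p = (endH k (+ α) p ≡ + β) × All (λ y → + 0 ≤ y) (heights k (+ α) p)

isDyck? : ∀ k α β p → Dec (IsDyck k α β p)
isDyck? k α β p = (endH k (+ α) p ℤ.≟ + β) ×-dec all? (λ y → + 0 ≤? y) (heights k (+ α) p)

IsBounded : ℕ → ℕ → ℕ → ℕ → List Step → Set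
IsBounded k M α β p = IsDyck k α β p × All (λ y → y ≤ + M) (heights k (+ α) p)

isBounded? : ∀ k M α β p → Dec (IsBounded k M α β p)
isBounded? k M α β p = isDyck? k α β p ×-dec all? (λ y → y ≤? + M) (heights k (+ α) p)

candidates : ℕ → ℕ → ℕ → ℕ → List (List Step)
candidates k n α β with (+ (k ℕ.* n) ℤ.+ + β) ℤ.- + α
... | + m      = allSeqs m
... | -[1+ _ ] = []

Ccount : ℕ → ℕ → ℕ → ℕ → ℕ
Ccount k α β n = length (filter (isDyck? k α β) (candidates k n α β))

Ucount : ℕ → ℕ → ℕ → ℕ → ℕ → ℕ
Ucount k M α β n = length (filter (isBounded? k M α β) (candidates k n α β))

Series : Set
Series = ℕ → ℕ

sumTo : ℕ → (ℕ → ℕ) → ℕ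
sumTo zero    f = f 0
sumTo (suc n) f = sumTo n f ℕ.+ f (suc n)

_⊛_ : Series → Series → Series
(a ⊛ b) n = sumTo n (λ i → a i ℕ.* b (n ℕ.∸ i))

1+ₛ : Series → Series
1+ₛ a zero    = suc (a zero)
1+ₛ a (suc n) = a (suc n)

private
  open import Relation.Binary.PropositionalEquality using (refl)
  t1 : Ccount 2 0 0 3 ≡ 5
  t1 = refl
  t2 : Ccount 3 0 0 2 ≡ 3
  t2 = refl
  t3 : Ucount 2 1 0 0 3 ≡ 1
  t3 = refl

-- Decompose a walk from α ≤ M to M that stays above the axis according to whether it ever
-- exceeds M. If it does, the first exit is an up step from M to M + 1, preceded by a walk
-- that stays in the strip [0, M] and followed by an arbitrary walk from M + 1 to M. Indexed by
-- length, this gives C = U + Σ_j U_j · C'_(m - 1 - j). A walk from α to M of length m has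
-- m ≡ M - α (mod k), so only the lengths M - α + i k contribute, and reindexing by the number
-- of down steps turns the sum into the Cauchy product of U and C_(M+1,M).
module Submission where

open import Defs
open import Data.Nat using (ℕ; suc; _≤_)
open import Relation.Binary.PropositionalEquality using (_≡_)

open import Data.Bool using (true; false; if_then_else_)
open import Data.Empty using (⊥-elim)
open import Data.Integer as ℤ using (ℤ; +_)
import Data.Integer.Properties as ℤₚ
import Data.Integer.Tactic.RingSolver as ℤ-Solver
open import Data.List using (List; []; _∷_; length; filter; map; _++_)
open import Data.List.Properties using (length-++; filter-++; filter-≐; filter-none)
open import Data.List.Relation.Unary.All as All using (All; []; _∷_; all?)
open import Data.Nat using (zero; _+_; _*_; _∸_; _<_; _≟_; z<s; s<s; NonZero)
import Data.Nat.Properties as ℕₚ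
open import Algebra.Properties.CommutativeSemigroup ℕₚ.+-commutativeSemigroup
  using (interchange; x∙yz≈y∙xz)
import Data.Nat.Tactic.RingSolver as ℕ-Solver
open import Data.Nat.Divisibility using (_∣_; divides; ∣m+n∣m⇒∣n; ∣-refl; ∣⇒≤)
open import Data.Product using (∃-syntax; _×_; _,_; proj₁)
open import Function using (_∘_)
open import Level using (0ℓ)
open import Relation.Binary.PropositionalEquality
  using (refl; sym; trans; cong; cong₂; subst; _≢_; module ≡-Reasoning)
open import Relation.Nullary using (Dec; yes; no; does; ¬_)
open import Relation.Nullary.Decidable using (_×-dec_; decidable-stable; dec-true; dec-false)
open import Relation.Unary using (Pred; Decidable; _≐_)

open ≡-Reasoning

length-filter-map : ∀ {A B : Set} {P : Pred B 0ℓ} (P? : Decidable P) (f : A → B) xs →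
  length (filter P? (map f xs)) ≡ length (filter (P? ∘ f) xs)
length-filter-map P? f []       = refl
length-filter-map P? f (x ∷ xs) with does (P? (f x))
... | true  = cong suc (length-filter-map P? f xs)
... | false = length-filter-map P? f xs

length-filter-singleton : ∀ {A : Set} {P : Pred A 0ℓ} (P? : Decidable P) x →
  length (filter P? (x ∷ [])) ≡ (if does (P? x) then 1 else 0)
length-filter-singleton P? x with does (P? x)
... | true  = refl
... | false = refl

∑ : ℕ → (ℕ → ℕ) → ℕ
∑ zero    f = 0
∑ (suc m) f = f 0 + ∑ m (f ∘ suc)

infix 6.5 ∑
syntax ∑ m (λ j → e) = ∑[ j < m ] e

∑-cong : ∀ m {f g : ℕ → ℕ} → (∀ {j} → j < m → f j ≡ g j) → ∑ m f ≡ ∑ m g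
∑-cong zero    f≡g = refl
∑-cong (suc m) f≡g = cong₂ _+_ (f≡g z<s) (∑-cong m (f≡g ∘ s<s))

∑-zero : ∀ m {f : ℕ → ℕ} → (∀ {j} → j < m → f j ≡ 0) → ∑ m f ≡ 0
∑-zero zero    f≡0 = refl
∑-zero (suc m) f≡0 = cong₂ _+_ (f≡0 z<s) (∑-zero m (f≡0 ∘ s<s))

∑-distrib-+ : ∀ m (f g : ℕ → ℕ) → ∑[ j < m ] (f j + g j) ≡ ∑ m f + ∑ m g
∑-distrib-+ zero    f g = refl
∑-distrib-+ (suc m) f g = begin
  (f 0 + g 0) + ∑[ j < m ] (f (suc j) + g (suc j))
    ≡⟨ cong (_+_ (f 0 + g 0)) (∑-distrib-+ m (f ∘ suc) (g ∘ suc)) ⟩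
  (f 0 + g 0) + (∑ m (f ∘ suc) + ∑ m (g ∘ suc))
    ≡⟨ interchange (f 0) (g 0) _ _ ⟩
  (f 0 + ∑ m (f ∘ suc)) + (g 0 + ∑ m (g ∘ suc)) ∎

∑-++ : ∀ a b (f : ℕ → ℕ) → ∑ (a + b) f ≡ ∑ a f + ∑[ j < b ] f (a + j)
∑-++ zero    b f = refl
∑-++ (suc a) b f = trans (cong (_+_ (f 0)) (∑-++ a b (f ∘ suc))) (sym (ℕₚ.+-assoc (f 0) _ _))

∑-snoc : ∀ n (f : ℕ → ℕ) → ∑ (suc n) f ≡ ∑ n f + f n
∑-snoc zero    f = ℕₚ.+-identityʳ (f 0)
∑-snoc (suc n) f = trans (cong (_+_ (f 0)) (∑-snoc n (f ∘ suc))) (sym (ℕₚ.+-assoc (f 0) _ _))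

sumTo≡∑+last : ∀ n f → sumTo n f ≡ ∑ n f + f n
sumTo≡∑+last zero    f = refl
sumTo≡∑+last (suc n) f = cong (_+ f (suc n)) (trans (sumTo≡∑+last n f) (sym (∑-snoc n f)))

∑-blocks : ∀ k .{{_ : NonZero k}} n (f : ℕ → ℕ) → (∀ j → f j ≢ 0 → k ∣ j) →
  ∑ (n * k) f ≡ ∑[ i < n ] f (i * k)
∑-blocks k       zero    f aligned = refl
∑-blocks (suc k) (suc n) f aligned = begin
  ∑ (suc k + n * suc k) f
    ≡⟨ ∑-++ (suc k) (n * suc k) f ⟩
  (f 0 + ∑ k (f ∘ suc)) + ∑[ j < n * suc k ] f (suc k + j)
    ≡⟨ cong₂ (λ x y → f 0 + x + y) inside-block
             (∑-blocks (suc k) n (f ∘ _+_ (suc k)) (λ j f≢0 → ∣m+n∣m⇒∣n (aligned (suc k + j) f≢0) ∣-refl)) ⟩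
  (f 0 + 0) + ∑[ i < n ] f (suc k + i * suc k)
    ≡⟨ cong (_+ ∑[ i < n ] f (suc k + i * suc k)) (ℕₚ.+-identityʳ (f 0)) ⟩
  f 0 + ∑[ i < n ] f (suc k + i * suc k) ∎
  where
  inside-block : ∑ k (f ∘ suc) ≡ 0
  inside-block = ∑-zero k λ {j} j<k → decidable-stable (f (suc j) ≟ 0)
    (λ f≢0 → ℕₚ.<⇒≱ (s<s j<k) (∣⇒≤ (aligned (suc j) f≢0)))

∑-aligned : ∀ k .{{_ : NonZero k}} r n (f : ℕ → ℕ) → (∀ j → f j ≢ 0 → ∃[ i ] j ≡ r + i * k) →
  ∑ (r + n * k) f ≡ ∑[ i < n ] f (r + i * k)
∑-aligned k r n f aligned = begin
  ∑ (r + n * k) f                          ≡⟨ ∑-++ r (n * k) f ⟩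
  ∑ r f + ∑[ j < n * k ] f (r + j)         ≡⟨ cong₂ _+_ before-r (∑-blocks k n (f ∘ _+_ r) divisible) ⟩
  ∑[ i < n ] f (r + i * k)                 ∎
  where
  before-r : ∑ r f ≡ 0
  before-r = ∑-zero r λ {j} j<r → decidable-stable (f j ≟ 0) λ f≢0 →
    let i , j≡r+ik = aligned j f≢0 in ℕₚ.<⇒≱ j<r (subst (r ≤_) (sym j≡r+ik) (ℕₚ.m≤m+n r (i * k)))
  divisible : ∀ j → f (r + j) ≢ 0 → k ∣ j
  divisible j f≢0 = let i , e = aligned (r + j) f≢0 in divides i (ℕₚ.+-cancelˡ-≡ r j (i * k) e)

-- walks m y counts the step sequences of length m from height y that end at height β and
-- visit only heights satisfying Ok.
module Walks (k : ℕ) {Ok : Pred ℤ 0ℓ} (ok? : Decidable Ok) (β : ℤ) where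

  Reaches : ℤ → List Step → Set
  Reaches y p = endH k y p ≡ β × All Ok (heights k y p)

  reaches? : ∀ y → Decidable (Reaches y)
  reaches? y p = (endH k y p ℤ.≟ β) ×-dec all? ok? (heights k y p)

  walks : ℕ → ℤ → ℕ
  walks zero    y = if does (reaches? y []) then 1 else 0
  walks (suc m) y = if does (ok? y) then walks m (stepH k U y) + walks m (stepH k D y) else 0

  walks-blocked : ∀ {y} → ¬ Ok y → ∀ m → walks m y ≡ 0
  walks-blocked {y} ¬ok zero =
    cong (if_then 1 else 0) (dec-false (reaches? y []) λ { (_ , ok ∷ []) → ¬ok ok })
  walks-blocked {y} ¬ok (suc m) with ok? y
  ... | yes ok = ⊥-elim (¬ok ok)
  ... | no _   = refl

  walks-step : ∀ {y} → Ok y → ∀ m → walks (suc m) y ≡ walks m (stepH k U y) + walks m (stepH k D y)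
  walks-step {y} ok m with ok? y
  ... | yes _  = refl
  ... | no ¬ok = ⊥-elim (¬ok ok)

  walks-off-target : ∀ {y} → y ≢ β → walks 0 y ≡ 0
  walks-off-target {y} y≢β = cong (if_then 1 else 0) (dec-false (reaches? y []) (y≢β ∘ proj₁))

  walks-at-target : Ok β → walks 0 β ≡ 1
  walks-at-target ok = cong (if_then 1 else 0) (dec-true (reaches? β []) (refl , ok ∷ []))

  reaches-cons : ∀ {y} s → Ok y → Reaches y ∘ (s ∷_) ≐ Reaches (stepH k s y)
  reaches-cons s ok = (λ { (e , _ ∷ oks) → e , oks }) , (λ { (e , oks) → e , ok ∷ oks })

  count-blocked : ∀ {y} s xs → ¬ Ok y → length (filter (reaches? y) (map (s ∷_) xs)) ≡ 0
  count-blocked {y} s xs ¬ok = begin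
    length (filter (reaches? y) (map (s ∷_) xs))  ≡⟨ length-filter-map (reaches? y) (s ∷_) xs ⟩
    length (filter (reaches? y ∘ (s ∷_)) xs)      ≡⟨ cong length (filter-none _ (All.universal (λ { _ (_ , ok ∷ _) → ¬ok ok }) xs)) ⟩
    0                                             ∎

  count-reaches : ∀ m y → length (filter (reaches? y) (allSeqs m)) ≡ walks m y
  count-step : ∀ {y} s m → Ok y → length (filter (reaches? y) (map (s ∷_) (allSeqs m))) ≡ walks m (stepH k s y)

  count-step {y} s m ok = begin
    length (filter (reaches? y) (map (s ∷_) (allSeqs m)))
      ≡⟨ length-filter-map (reaches? y) (s ∷_) (allSeqs m) ⟩
    length (filter (reaches? y ∘ (s ∷_)) (allSeqs m))
      ≡⟨ cong length (filter-≐ _ (reaches? (stepH k s y)) (reaches-cons s ok) (allSeqs m)) ⟩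
    length (filter (reaches? (stepH k s y)) (allSeqs m))
      ≡⟨ count-reaches m (stepH k s y) ⟩
    walks m (stepH k s y) ∎

  count-reaches zero    y = length-filter-singleton (reaches? y) []
  count-reaches (suc m) y = begin
    length (filter (reaches? y) (map (U ∷_) S ++ map (D ∷_) S))
      ≡⟨ cong length (filter-++ (reaches? y) (map (U ∷_) S) (map (D ∷_) S)) ⟩
    length (filter (reaches? y) (map (U ∷_) S) ++ filter (reaches? y) (map (D ∷_) S))
      ≡⟨ length-++ (filter (reaches? y) (map (U ∷_) S)) ⟩
    branch U + branch D
      ≡⟨ branches (ok? y) ⟩
    walks (suc m) y ∎
    where
    S : List (List Step)
    S = allSeqs m
    branch : Step → ℕ
    branch s = length (filter (reaches? y) (map (s ∷_) S))
    branches : Dec (Ok y) → branch U + branch D ≡ walks (suc m) y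
    branches (yes ok) = trans (cong₂ _+_ (count-step U m ok) (count-step D m ok)) (sym (walks-step ok m))
    branches (no ¬ok) = trans (cong₂ _+_ (count-blocked U S ¬ok) (count-blocked D S ¬ok)) (sym (walks-blocked ¬ok (suc m)))

  walks-aligned : ∀ j y → walks j y ≢ 0 → ∃[ d ] y ℤ.+ + j ≡ β ℤ.+ + (d * k)
  walks-aligned zero y w≢0 = 0 , cong (ℤ._+ + 0) y≡β
    where
    y≡β : y ≡ β
    y≡β = proj₁ (decidable-stable (reaches? y []) (w≢0 ∘ cong (if_then 1 else 0) ∘ dec-false (reaches? y [])))
  walks-aligned (suc j) y w≢0 with walks j (stepH k U y) ≟ 0
  ... | no up≢0 = let d , e = walks-aligned j (stepH k U y) up≢0 in
    d , trans (up-shift y (+ j)) e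
    where
    up-shift : ∀ y j → y ℤ.+ (+ 1 ℤ.+ j) ≡ (y ℤ.+ + 1) ℤ.+ j
    up-shift = ℤ-Solver.solve-∀
  ... | yes up≡0 = let d , e = walks-aligned j (stepH k D y) down≢0 in
    suc d , trans (down-shift y (+ j) (+ k)) (trans (cong (ℤ._+ + k) e) (regroup β (+ (d * k)) (+ k)))
    where
    ok : Ok y
    ok = decidable-stable (ok? y) (λ ¬ok → w≢0 (walks-blocked ¬ok (suc j)))
    down≢0 : walks j (stepH k D y) ≢ 0
    down≢0 down≡0 = w≢0 (trans (walks-step ok j) (cong₂ _+_ up≡0 down≡0))
    down-shift : ∀ y j k → y ℤ.+ (+ 1 ℤ.+ j) ≡ (((y ℤ.+ + 1) ℤ.- k) ℤ.+ j) ℤ.+ k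
    down-shift = ℤ-Solver.solve-∀
    regroup : ∀ b e k → (b ℤ.+ e) ℤ.+ k ≡ b ℤ.+ (k ℤ.+ e)
    regroup = ℤ-Solver.solve-∀

NonNeg : Pred ℤ 0ℓ
NonNeg y = + 0 ℤ.≤ y

nonNeg? : Decidable NonNeg
nonNeg? y = + 0 ℤ.≤? y

Within : ℕ → Pred ℤ 0ℓ
Within M y = NonNeg y × y ℤ.≤ + M

within? : ∀ M → Decidable (Within M)
within? M y = nonNeg? y ×-dec y ℤ.≤? + M

module Dyck (k : ℕ) = Walks k nonNeg?
module Bounded (k M : ℕ) = Walks k (within? M)

private
  a+m-a≡m : ∀ a m → (a ℤ.+ m) ℤ.- a ≡ m
  a+m-a≡m = ℤ-Solver.solve-∀

  a-[1+a+g]≡-[1+g] : ∀ a g → a ℤ.- (+ 1 ℤ.+ (a ℤ.+ g)) ≡ ℤ.- (+ 1 ℤ.+ g)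
  a-[1+a+g]≡-[1+g] = ℤ-Solver.solve-∀

candidates-long : ∀ {k n α β m} → k * n + β ≡ α + m → candidates k n α β ≡ allSeqs m
candidates-long {k} {n} {α} {β} {m} e rewrite e | a+m-a≡m (+ α) (+ m) = refl

candidates-short : ∀ {k n α β} → k * n + β < α → candidates k n α β ≡ []
candidates-short {k} {n} {α} {β} lt
  rewrite sym (ℕₚ.m+[n∸m]≡n lt) | a-[1+a+g]≡-[1+g] (+ (k * n + β)) (+ (α ∸ suc (k * n + β))) = refl

Ccount-walks : ∀ {k n α β m} → k * n + β ≡ α + m → Ccount k α β n ≡ Dyck.walks k (+ β) m (+ α)
Ccount-walks {k} {n} {α} {β} {m} e = begin
  length (filter (isDyck? k α β) (candidates k n α β))
    ≡⟨ cong (length ∘ filter (isDyck? k α β)) (candidates-long {k} {n} {α} {β} e) ⟩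
  length (filter (isDyck? k α β) (allSeqs m))
    ≡⟨ Dyck.count-reaches k (+ β) m (+ α) ⟩
  Dyck.walks k (+ β) m (+ α) ∎

Ccount-short : ∀ {k n α β} → k * n + β < α → Ccount k α β n ≡ 0
Ccount-short {k} {n} {α} {β} lt = cong (length ∘ filter (isDyck? k α β)) (candidates-short {k} {n} lt)

Ucount-walks : ∀ {k M n α β m} → k * n + β ≡ α + m → Ucount k M α β n ≡ Bounded.walks k M (+ β) m (+ α)
Ucount-walks {k} {M} {n} {α} {β} {m} e = begin
  length (filter (isBounded? k M α β) (candidates k n α β))
    ≡⟨ cong (length ∘ filter (isBounded? k M α β)) (candidates-long {k} {n} {α} {β} e) ⟩
  length (filter (isBounded? k M α β) (allSeqs m))
    ≡⟨ cong length (filter-≐ (isBounded? k M α β) (reaches? (+ α)) bounded≐reaches (allSeqs m)) ⟩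
  length (filter (reaches? (+ α)) (allSeqs m))
    ≡⟨ count-reaches m (+ α) ⟩
  walks m (+ α) ∎
  where
  open Bounded k M (+ β)
  bounded≐reaches : IsBounded k M α β ≐ Reaches (+ α)
  bounded≐reaches = (λ { ((e , ≥0) , ≤M) → e , All.zip (≥0 , ≤M) })
                  , (λ { (e , within) → let ≥0 , ≤M = All.unzip within in (e , ≥0) , ≤M })

module FirstPassage (k′ M : ℕ) where

  k : ℕ
  k = suc k′

  dyck bounded : ℕ → ℤ → ℕ
  dyck    = Dyck.walks k (+ M)
  bounded = Bounded.walks k M (+ M)

  crossing : ℕ → ℤ → ℕ
  crossing m y = ∑[ j < m ] bounded j y * dyck (m ∸ suc j) (+ suc M)

  Decomposes : ℕ → Set
  Decomposes m = ∀ y → y ℤ.≤ + M → dyck m y ≡ bounded m y + crossing m y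

  down≤ : ∀ y → stepH k D y ℤ.≤ y
  down≤ y = subst (ℤ._≤ y) (sym (shift y (+ k′))) (ℤₚ.i-j≤i y (+ k′))
    where
    shift : ∀ y k′ → (y ℤ.+ + 1) ℤ.- (+ 1 ℤ.+ k′) ≡ y ℤ.- k′
    shift = ℤ-Solver.solve-∀

  up≤ : ∀ {y} → y ℤ.≤ + M → y ≢ + M → stepH k U y ℤ.≤ + M
  up≤ {y} y≤M y≢M = subst (ℤ._≤ + M) (ℤₚ.+-comm (+ 1) y) (ℤₚ.i<j⇒suc[i]≤j (ℤₚ.≤∧≢⇒< y≤M y≢M))

  up-from-M : stepH k U (+ M) ≡ + suc M
  up-from-M = cong +_ (ℕₚ.+-comm M 1)

  bounded-above-M : ∀ j → bounded j (+ suc M) ≡ 0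
  bounded-above-M = Bounded.walks-blocked k M (+ M) λ { (_ , ℤ.+≤+ 1+M≤M) → ℕₚ.1+n≰n 1+M≤M }

  crossing-step : ∀ {y} → Within M y → ∀ m →
    crossing (suc m) y ≡ bounded 0 y * dyck m (+ suc M) + (crossing m (stepH k U y) + crossing m (stepH k D y))
  crossing-step {y} within m = cong (_+_ (bounded 0 y * dyck m (+ suc M))) (begin
    ∑[ j < m ] bounded (suc j) y * rest j
      ≡⟨ ∑-cong m (λ {j} _ → trans (cong (_* rest j) (Bounded.walks-step k M (+ M) within j))
                                  (ℕₚ.*-distribʳ-+ (rest j) (bounded j y↑) (bounded j y↓))) ⟩
    ∑[ j < m ] (bounded j y↑ * rest j + bounded j y↓ * rest j)
      ≡⟨ ∑-distrib-+ m _ _ ⟩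
    crossing m y↑ + crossing m y↓ ∎)
    where
    y↑ y↓ : ℤ
    y↑ = stepH k U y
    y↓ = stepH k D y
    rest : ℕ → ℕ
    rest j = dyck (m ∸ suc j) (+ suc M)

  decomposes-below-axis : ∀ m {y} → ¬ NonNeg y → dyck m y ≡ bounded m y + crossing m y
  decomposes-below-axis m {y} y<0 = begin
    dyck m y                   ≡⟨ Dyck.walks-blocked k (+ M) y<0 m ⟩
    0                          ≡⟨ cong₂ _+_ (bounded≡0 m) (∑-zero m λ {j} _ → cong (_* _) (bounded≡0 j)) ⟨
    bounded m y + crossing m y ∎
    where
    bounded≡0 : ∀ j → bounded j y ≡ 0
    bounded≡0 = Bounded.walks-blocked k M (+ M) (y<0 ∘ proj₁)

  decomposes-zero-at-M : NonNeg (+ M) → dyck 0 (+ M) ≡ bounded 0 (+ M) + crossing 0 (+ M)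
  decomposes-zero-at-M 0≤M = begin
    dyck 0 (+ M)        ≡⟨ Dyck.walks-at-target k (+ M) 0≤M ⟩
    1                   ≡⟨ Bounded.walks-at-target k M (+ M) (0≤M , ℤₚ.≤-refl) ⟨
    bounded 0 (+ M)     ≡⟨ ℕₚ.+-identityʳ _ ⟨
    bounded 0 (+ M) + 0 ∎

  decomposes-zero-off-M : ∀ {y} → y ≢ + M → dyck 0 y ≡ bounded 0 y + crossing 0 y
  decomposes-zero-off-M {y} y≢M = begin
    dyck 0 y            ≡⟨ Dyck.walks-off-target k (+ M) y≢M ⟩
    0                   ≡⟨ Bounded.walks-off-target k M (+ M) y≢M ⟨
    bounded 0 y         ≡⟨ ℕₚ.+-identityʳ _ ⟨
    bounded 0 y + 0     ∎

  decomposes-suc-at-M : ∀ {m} → Decomposes m → NonNeg (+ M) →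
    dyck (suc m) (+ M) ≡ bounded (suc m) (+ M) + crossing (suc m) (+ M)
  decomposes-suc-at-M {m} ih 0≤M = begin
    dyck (suc m) (+ M)
      ≡⟨ Dyck.walks-step k (+ M) 0≤M m ⟩
    dyck m M↑ + dyck m M↓
      ≡⟨ cong₂ _+_ (cong (dyck m) up-from-M) (ih M↓ (down≤ (+ M))) ⟩
    return + (bounded m M↓ + crossing m M↓)
      ≡⟨ x∙yz≈y∙xz return (bounded m M↓) (crossing m M↓) ⟩
    bounded m M↓ + (return + crossing m M↓)
      ≡⟨ cong₂ _+_ bounded-step crossing-step′ ⟨
    bounded (suc m) (+ M) + crossing (suc m) (+ M) ∎
    where
    M↑ M↓ : ℤ
    M↑ = stepH k U (+ M)
    M↓ = stepH k D (+ M)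
    return : ℕ
    return = dyck m (+ suc M)
    at-M : Within M (+ M)
    at-M = 0≤M , ℤₚ.≤-refl
    bounded-step : bounded (suc m) (+ M) ≡ bounded m M↓
    bounded-step = begin
      bounded (suc m) (+ M)              ≡⟨ Bounded.walks-step k M (+ M) at-M m ⟩
      bounded m M↑ + bounded m M↓        ≡⟨ cong (λ h → bounded m h + bounded m M↓) up-from-M ⟩
      bounded m (+ suc M) + bounded m M↓ ≡⟨ cong (_+ bounded m M↓) (bounded-above-M m) ⟩
      bounded m M↓                       ∎
    crossing-step′ : crossing (suc m) (+ M) ≡ return + crossing m M↓
    crossing-step′ = begin
      crossing (suc m) (+ M)
        ≡⟨ crossing-step at-M m ⟩
      bounded 0 (+ M) * return + (crossing m M↑ + crossing m M↓)
        ≡⟨ cong₂ (λ b c → b * return + (c + crossing m M↓))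
                 (Bounded.walks-at-target k M (+ M) at-M)
                 (trans (cong (crossing m) up-from-M)
                        (∑-zero m λ {j} _ → cong (_* dyck (m ∸ suc j) (+ suc M)) (bounded-above-M j))) ⟩
      1 * return + crossing m M↓
        ≡⟨ cong (_+ crossing m M↓) (ℕₚ.*-identityˡ return) ⟩
      return + crossing m M↓ ∎

  decomposes-suc-below-M : ∀ {m y} → Decomposes m → Within M y → y ≢ + M →
    dyck (suc m) y ≡ bounded (suc m) y + crossing (suc m) y
  decomposes-suc-below-M {m} {y} ih within@(0≤y , y≤M) y≢M = begin
    dyck (suc m) y
      ≡⟨ Dyck.walks-step k (+ M) 0≤y m ⟩
    dyck m y↑ + dyck m y↓
      ≡⟨ cong₂ _+_ (ih y↑ (up≤ y≤M y≢M)) (ih y↓ (ℤₚ.≤-trans (down≤ y) y≤M)) ⟩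
    (bounded m y↑ + crossing m y↑) + (bounded m y↓ + crossing m y↓)
      ≡⟨ interchange (bounded m y↑) (crossing m y↑) _ _ ⟩
    (bounded m y↑ + bounded m y↓) + (crossing m y↑ + crossing m y↓)
      ≡⟨ cong₂ _+_ (Bounded.walks-step k M (+ M) within m) crossing-step′ ⟨
    bounded (suc m) y + crossing (suc m) y ∎
    where
    y↑ y↓ : ℤ
    y↑ = stepH k U y
    y↓ = stepH k D y
    crossing-step′ : crossing (suc m) y ≡ crossing m y↑ + crossing m y↓
    crossing-step′ = trans (crossing-step within m)
      (cong (λ b → b * dyck m (+ suc M) + (crossing m y↑ + crossing m y↓)) (Bounded.walks-off-target k M (+ M) y≢M))

  first-passage : ∀ m → Decomposes m
  first-passage m y y≤M with nonNeg? y | y ℤ.≟ + M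
  ... | no y<0 | _ = decomposes-below-axis m y<0
  first-passage zero    .(+ M) _   | yes 0≤M | yes refl = decomposes-zero-at-M 0≤M
  first-passage zero    y      _   | yes _   | no y≢M   = decomposes-zero-off-M y≢M
  first-passage (suc m) .(+ M) _   | yes 0≤M | yes refl = decomposes-suc-at-M {m} (first-passage m) 0≤M
  first-passage (suc m) y      y≤M | yes 0≤y | no y≢M   = decomposes-suc-below-M {m} (first-passage m) (0≤y , y≤M) y≢M

module Convolution (k′ α r : ℕ) where

  open FirstPassage k′ (α + r)

  M : ℕ
  M = α + r

  returns : ℕ → ℕ
  returns = Ccount k (suc M) M

  summand : ℕ → ℕ → ℕ
  summand L j = bounded j (+ α) * dyck (L ∸ suc j) (+ suc M)

  Ucount-aligned : ∀ i → Ucount k M α M i ≡ bounded (r + i * k) (+ α)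
  Ucount-aligned i = Ucount-walks {k} {M} {i} {α} {M} {r + i * k} (extent k′ α r i)
    where
    extent : ∀ k′ α r i → suc k′ * i + (α + r) ≡ α + (r + i * suc k′)
    extent = ℕ-Solver.solve-∀

  Ccount-aligned : ∀ n → Ccount k α M n ≡ dyck (r + n * k) (+ α)
  Ccount-aligned n = Ccount-walks {k} {n} {α} {M} {r + n * k} (extent k′ α r n)
    where
    extent : ∀ k′ α r n → suc k′ * n + (α + r) ≡ α + (r + n * suc k′)
    extent = ℕ-Solver.solve-∀

  returns-suc : ∀ t → returns (suc t) ≡ dyck (k′ + t * k) (+ suc M)
  returns-suc t = Ccount-walks {k} {suc t} {suc M} {M} {k′ + t * k} (extent k′ t M)
    where
    extent : ∀ k′ t M → suc k′ * suc t + M ≡ suc M + (k′ + t * suc k′)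
    extent = ℕ-Solver.solve-∀

  returns-zero : returns 0 ≡ 0
  returns-zero = Ccount-short {k} {0} (subst (_< suc M) (sym (cong (_+ M) (ℕₚ.*-zeroʳ k))) ℕₚ.≤-refl)

  product-term : ∀ {n} i t → suc i + t ≡ n →
    Ucount k M α M i * 1+ₛ returns (n ∸ i) ≡ summand (r + n * k) (r + i * k)
  product-term i t refl = cong₂ _*_ (Ucount-aligned i) (begin
    1+ₛ returns (suc i + t ∸ i)    ≡⟨ cong (1+ₛ returns) (trans (cong (_∸ i) (sym (ℕₚ.+-suc i t))) (ℕₚ.m+n∸m≡n i (suc t))) ⟩
    returns (suc t)                ≡⟨ returns-suc t ⟩
    dyck (k′ + t * k) (+ suc M)    ≡⟨ cong (λ l → dyck l (+ suc M)) remaining ⟨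
    dyck (r + (suc i + t) * k ∸ suc (r + i * k)) (+ suc M) ∎)
    where
    split : ∀ k′ r i t → r + (suc i + t) * suc k′ ≡ suc (r + i * suc k′) + (k′ + t * suc k′)
    split = ℕ-Solver.solve-∀
    remaining : r + (suc i + t) * k ∸ suc (r + i * k) ≡ k′ + t * k
    remaining = trans (cong (_∸ suc (r + i * k)) (split k′ r i t)) (ℕₚ.m+n∸m≡n (suc (r + i * k)) _)

  summand-aligned : ∀ L j → summand L j ≢ 0 → ∃[ i ] j ≡ r + i * k
  summand-aligned L j summand≢0 =
    let i , e = Bounded.walks-aligned k M (+ M) j (+ α) bounded≢0
    in i , ℕₚ.+-cancelˡ-≡ α j (r + i * k) (trans (ℤₚ.+-injective e) (ℕₚ.+-assoc α r (i * k)))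
    where
    bounded≢0 : bounded j (+ α) ≢ 0
    bounded≢0 b≡0 = summand≢0 (cong (_* dyck (L ∸ suc j) (+ suc M)) b≡0)

  convolution : ∀ n → (Ucount k M α M ⊛ 1+ₛ returns) n ≡ Ccount k α M n
  convolution n = begin
    sumTo n term
      ≡⟨ sumTo≡∑+last n term ⟩
    ∑ n term + term n
      ≡⟨ cong₂ _+_ (∑-cong n λ {i} i<n → product-term i (n ∸ suc i) (ℕₚ.m+[n∸m]≡n i<n)) last-term ⟩
    ∑[ i < n ] summand L (r + i * k) + bounded L (+ α)
      ≡⟨ ℕₚ.+-comm _ (bounded L (+ α)) ⟩
    bounded L (+ α) + ∑[ i < n ] summand L (r + i * k)
      ≡⟨ cong (_+_ (bounded L (+ α))) (∑-aligned k r n (summand L) (summand-aligned L)) ⟨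
    bounded L (+ α) + crossing L (+ α)
      ≡⟨ first-passage L (+ α) (ℤ.+≤+ (ℕₚ.m≤m+n α r)) ⟨
    dyck L (+ α)
      ≡⟨ Ccount-aligned n ⟨
    Ccount k α M n ∎
    where
    L : ℕ
    L = r + n * k
    term : ℕ → ℕ
    term i = Ucount k M α M i * 1+ₛ returns (n ∸ i)
    last-term : term n ≡ bounded L (+ α)
    last-term = begin
      Ucount k M α M n * 1+ₛ returns (n ∸ n) ≡⟨ cong₂ _*_ (Ucount-aligned n) (cong (1+ₛ returns) (ℕₚ.n∸n≡0 n)) ⟩
      bounded L (+ α) * suc (returns 0)      ≡⟨ cong (λ c → bounded L (+ α) * suc c) returns-zero ⟩
      bounded L (+ α) * 1                    ≡⟨ ℕₚ.*-identityʳ _ ⟩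
      bounded L (+ α)                        ∎

-- The identity already holds for k ≥ 1.
lemma4p1 : (k M α : ℕ) → 2 ≤ k → α ≤ M →
    (n : ℕ) → (Ucount k M α M ⊛ 1+ₛ (Ccount k (suc M) M)) n ≡ Ccount k α M n
lemma4p1 (suc k′) M α _ α≤M n =
  subst (λ M → (Ucount (suc k′) M α M ⊛ 1+ₛ (Ccount (suc k′) (suc M) M)) n ≡ Ccount (suc k′) α M n)
        (ℕₚ.m+[n∸m]≡n α≤M)
        (Convolution.convolution k′ α (M ∸ α) n)
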